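{- Let $G$ be a finite group, $H$ a subgroup of $G$, and $S$ an inverse-closed subset of $G\setminus\{e\}$. Let $a$ and $b$ be nonnegative integers. Suppose that $H$ is a perfect code in some Cayley graph $\mathrm{Cay}(G,S_0)$ of $G$. Then $H$ is an $(a,b)$-regular set in $\mathrm{Cay}(G,S)$ if and only if $|S\cap H|=a$ and $\overline{S\setminus H}\cdot\overline{H}=b\,\overline{S_0}\cdot\overline{H}$ in $\mathbb{Z}[G]$.
   Context: $e$ is the identity of $G$. For an inverse-closed subset $S\subseteq G\setminus\{e\}$, the Cayley graph $\mathrm{Cay}(G,S)$ has vertex set $G$, with $x,y$ adjacent iff $yx^{ -1}\in S$. For a graph with vertex set $V$ and nonnegative integers $a,b$, an $(a,b)$-regular set is a nonempty proper subset $C\subset V$ such that every vertex of $C$ has exactly $a$ neighbours in $C$ and every vertex of $V\setminus C$ has exactly $b$ neighbours in $C$; a perfect code is a $(0,1)$-regular set. $\mathbb{Z}[G]$ is the integral group ring of $G$, and for a subset $A\subseteq G$, $\overline{A}=\sum_{g\in A}g\in\mathbb{Z}[G]$. -}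

module Defs where

open import Level using (0ℓ)
open import Data.Bool using (Bool; true; false; _∧_; not; if_then_else_; T)
open import Data.Bool.Properties using (T?)
open import Data.Nat using (ℕ)
open import Data.Integer using (ℤ; +_; _+_; _*_)
open import Data.List using (List; filter; length; foldr; map)
open import Data.List.Membership.Propositional using (_∈_)
open import Data.List.Relation.Unary.Unique.Propositional using (Unique)
open import Data.Product using (Σ; _×_; _,_; ∃)
open import Relation.Binary.PropositionalEquality using (_≡_; _≢_)
open import Relation.Binary.Definitions using (DecidableEquality)
open import Relation.Nullary using (¬_)
open import Relation.Nullary.Decidable using (does)
open import Algebra.Structures using (IsGroup)

record FiniteGroup : Set₁ where
  field
    Carrier  : Set
    _∙_      : Carrier → Carrier → Carrier
    ε        : Carrier
    _⁻¹      : Carrier → Carrier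
    isGroup  : IsGroup _≡_ _∙_ ε _⁻¹
    _≟_      : DecidableEquality Carrier
    elements : List Carrier
    complete : ∀ x → x ∈ elements
    unique   : Unique elements
  infixl 7 _∙_
  infix 8 _⁻¹

module _ (G : FiniteGroup) where
  open FiniteGroup G

  Subset : Set
  Subset = Carrier → Bool

  _∈ₛ_ : Carrier → Subset → Set
  x ∈ₛ A = A x ≡ true

  card : Subset → ℕ
  card A = length (filter (λ x → T? (A x)) elements)

  _∩_ : Subset → Subset → Subset
  (A ∩ B) x = A x ∧ B x

  _∖_ : Subset → Subset → Subset
  (A ∖ B) x = A x ∧ not (B x)

  record IsSubgroup (H : Subset) : Set where
    field
      ε∈    : ε ∈ₛ H
      ∙∈    : ∀ {x y} → x ∈ₛ H → y ∈ₛ H → (x ∙ y) ∈ₛ H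
      ⁻¹∈   : ∀ {x} → x ∈ₛ H → (x ⁻¹) ∈ₛ H

  record IsConnectionSet (S : Subset) : Set where
    field
      e∉    : ¬ (ε ∈ₛ S)
      inv   : ∀ {x} → x ∈ₛ S → (x ⁻¹) ∈ₛ S

  Adjacent : Subset → Carrier → Carrier → Bool
  Adjacent S x y = S (y ∙ x ⁻¹)

  neighboursIn : Subset → Subset → Carrier → ℕ
  neighboursIn S C x = card (λ y → Adjacent S x y ∧ C y)

  record IsRegularSet (S : Subset) (a b : ℕ) (C : Subset) : Set where
    field
      nonempty : ∃ λ x → x ∈ₛ C
      proper   : ∃ λ x → ¬ (x ∈ₛ C)
      inside   : ∀ x → x ∈ₛ C → neighboursIn S C x ≡ a
      outside  : ∀ x → ¬ (x ∈ₛ C) → neighboursIn S C x ≡ b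

  IsPerfectCode : Subset → Subset → Set
  IsPerfectCode S C = IsRegularSet S 0 1 C

  -- The integral group ring ℤ[G]: elements are coefficient functions G → ℤ
  -- (G finite, so every function is finitely supported).
  ZG : Set
  ZG = Carrier → ℤ

  Σ[G] : (Carrier → ℤ) → ℤ
  Σ[G] f = foldr _+_ (+ 0) (map f elements)

  _·_ : ZG → ZG → ZG
  (x · y) g = Σ[G] (λ u → x u * y (u ⁻¹ ∙ g))

  _⋆_ : ℤ → ZG → ZG
  (n ⋆ x) g = n * x g

  bar : Subset → ZG
  bar A g = if A g then + 1 else + 0

  _≈ZG_ : ZG → ZG → Set
  x ≈ZG y = ∀ g → x g ≡ y g

-- Evaluating the group-ring product at x gives (Ā · C̄)(x) = #{u ∈ A : u⁻¹x ∈ C}, and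
-- the substitution u = x y⁻¹ turns this into #{y ∈ C : y x⁻¹ ∈ A} whenever A = A⁻¹, i.e.
-- into the number of neighbours of x in C inside Cay(G, A).  For the subgroup H, a vertex
-- x ∈ H has exactly |S ∩ H| neighbours in H and none across an edge from S ∖ H, while a
-- vertex x ∉ H sees H only through S ∖ H.  Since H is a perfect code in Cay(G, S₀), the
-- coefficient of (b S̄₀ H̄) at x is 0 for x ∈ H and b for x ∉ H, so the group-ring identity
-- says exactly that every vertex outside H has b neighbours in H.
module Submission where

open import Algebra.Bundles using (Group)
import Algebra.Properties.Group as GroupProperties
open import Data.Bool using (Bool; true; false; _∧_; not; if_then_else_)
open import Data.Bool.Properties using (T?; ¬-not)
import Data.Bool as Bool
open import Data.Integer using (ℤ; +_)
import Data.Integer as ℤ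
open import Data.Integer.Properties using (+-identityˡ; +-injective; pos-*)
open import Data.List using (List; []; _∷_; filter; length; foldr; map)
open import Data.List.Properties using (map-cong)
open import Data.List.Membership.Propositional using (_∈_)
open import Data.List.Membership.Propositional.Properties using (∈-map⁺)
open import Data.List.Membership.Propositional.Properties.WithK using (unique∧set⇒bag)
open import Data.List.Relation.Binary.BagAndSetEquality using (∼bag⇒↭)
open import Data.List.Relation.Binary.Permutation.Propositional using (_↭_)
open import Data.List.Relation.Binary.Permutation.Propositional.Properties using (↭-length; filter-↭)
import Data.List.Relation.Unary.Unique.Propositional.Properties as Unique
open import Data.Nat using (ℕ; suc; _*_)
open import Data.Nat.Properties using (*-zeroʳ; *-identityʳ)
open import Data.Product using (_×_; _,_)
open import Function.Base using (_∘_)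
open import Function.Bundles using (_⇔_; mk⇔; Equivalence)
open import Relation.Binary.PropositionalEquality
  using (_≡_; refl; sym; trans; cong; cong₂; subst; module ≡-Reasoning)
open import Relation.Nullary using (¬_; yes; no; contradiction)

open import Defs

≡true-ext : ∀ {p q : Bool} → (p ≡ true → q ≡ true) → (q ≡ true → p ≡ true) → p ≡ q
≡true-ext {false} {false} _ _ = refl
≡true-ext {false} {true} _ q⇒p = q⇒p refl
≡true-ext {true} {false} p⇒q _ = sym (p⇒q refl)
≡true-ext {true} {true} _ _ = refl

indicator : Bool → ℤ
indicator p = if p then + 1 else + 0

indicator-∧ : ∀ p q → indicator p ℤ.* indicator q ≡ indicator (p ∧ q)
indicator-∧ true true = refl
indicator-∧ true false = refl
indicator-∧ false q = refl

[p∧¬q]∧q≡false : ∀ p q → (p ∧ not q) ∧ q ≡ false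
[p∧¬q]∧q≡false false q = refl
[p∧¬q]∧q≡false true false = refl
[p∧¬q]∧q≡false true true = refl

[p∧¬q]∧r≡p∧r : ∀ p q r → (r ≡ true → q ≡ false) → (p ∧ not q) ∧ r ≡ p ∧ r
[p∧¬q]∧r≡p∧r false q r _ = refl
[p∧¬q]∧r≡p∧r true false r _ = refl
[p∧¬q]∧r≡p∧r true true false _ = refl
[p∧¬q]∧r≡p∧r true true true r⇒¬q = contradiction (r⇒¬q refl) λ ()

module _ {A : Set} where

  count : (A → Bool) → List A → ℕ
  count P xs = length (filter (T? ∘ P) xs)

  count-cong : ∀ {P Q : A → Bool} → (∀ x → P x ≡ Q x) → ∀ xs → count P xs ≡ count Q xs
  count-cong P≗Q [] = refl
  count-cong {P} {Q} P≗Q (x ∷ xs) with P x | Q x | P≗Q x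
  ... | true | .true | refl = cong suc (count-cong P≗Q xs)
  ... | false | .false | refl = count-cong P≗Q xs

  count-false : ∀ xs → count (λ _ → false) xs ≡ 0
  count-false [] = refl
  count-false (_ ∷ xs) = count-false xs

  count-∘ : ∀ (P : A → Bool) (f : A → A) xs → count (P ∘ f) xs ≡ count P (map f xs)
  count-∘ P f [] = refl
  count-∘ P f (x ∷ xs) with P (f x)
  ... | true = cong suc (count-∘ P f xs)
  ... | false = count-∘ P f xs

  sum-indicator : ∀ (P : A → Bool) xs
    → foldr ℤ._+_ (+ 0) (map (indicator ∘ P) xs) ≡ + count P xs
  sum-indicator P [] = refl
  sum-indicator P (x ∷ xs) with P x
  ... | true = cong (ℤ._+_ (+ 1)) (sum-indicator P xs)
  ... | false = trans (+-identityˡ _) (sum-indicator P xs)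

module _ (G : FiniteGroup) where
  open FiniteGroup G

  private
    group : Group _ _
    group = record { isGroup = isGroup }

  open GroupProperties group
    using (⁻¹-involutive; ⁻¹-anti-homo-∙; \\-leftDividesˡ; //-rightDividesˡ; //-rightDividesʳ)

  card-cong : ∀ {A B : Subset G} → (∀ x → A x ≡ B x) → card G A ≡ card G B
  card-cong A≗B = count-cong A≗B elements

  card-∘-inverse : ∀ (A : Subset G) {f g : Carrier → Carrier}
    → (∀ x → g (f x) ≡ x) → (∀ y → f (g y) ≡ y) → card G (A ∘ f) ≡ card G A
  card-∘-inverse A {f} {g} gf≗id fg≗id =
    trans (count-∘ A f elements) (↭-length (filter-↭ (T? ∘ A) map-f-elements↭elements))
    where
      f-injective : ∀ {x y} → f x ≡ f y → x ≡ y
      f-injective {x} {y} fx≡fy = trans (sym (gf≗id x)) (trans (cong g fx≡fy) (gf≗id y))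

      ∈-map-f : ∀ z → z ∈ map f elements
      ∈-map-f z = subst (_∈ map f elements) (fg≗id z) (∈-map⁺ f (complete (g z)))

      map-f-elements↭elements : map f elements ↭ elements
      map-f-elements↭elements = ∼bag⇒↭ (unique∧set⇒bag (Unique.map⁺ f-injective unique) unique
        (λ {z} → mk⇔ (λ _ → complete z) (λ _ → ∈-map-f z)))

  Σ[G]-bar : ∀ A → Σ[G] G (bar G A) ≡ + card G A
  Σ[G]-bar A = sum-indicator A elements

  [x∙y⁻¹]⁻¹≡y∙x⁻¹ : ∀ x y → (x ∙ y ⁻¹) ⁻¹ ≡ y ∙ x ⁻¹
  [x∙y⁻¹]⁻¹≡y∙x⁻¹ x y = trans (⁻¹-anti-homo-∙ x (y ⁻¹)) (cong (_∙ x ⁻¹) (⁻¹-involutive y))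

  [x∙y⁻¹]⁻¹∙x≡y : ∀ x y → (x ∙ y ⁻¹) ⁻¹ ∙ x ≡ y
  [x∙y⁻¹]⁻¹∙x≡y x y = trans (cong (_∙ x) ([x∙y⁻¹]⁻¹≡y∙x⁻¹ x y)) (//-rightDividesˡ x y)

  x∙[y⁻¹∙x]⁻¹≡y : ∀ x y → x ∙ (y ⁻¹ ∙ x) ⁻¹ ≡ y
  x∙[y⁻¹∙x]⁻¹≡y x y = begin
    x ∙ (y ⁻¹ ∙ x) ⁻¹     ≡⟨ cong (x ∙_) (⁻¹-anti-homo-∙ (y ⁻¹) x) ⟩
    x ∙ (x ⁻¹ ∙ y ⁻¹ ⁻¹)  ≡⟨ cong (λ z → x ∙ (x ⁻¹ ∙ z)) (⁻¹-involutive y) ⟩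
    x ∙ (x ⁻¹ ∙ y)        ≡⟨ \\-leftDividesˡ x y ⟩
    y                     ∎
    where open ≡-Reasoning

  InverseClosed : Subset G → Set
  InverseClosed A = ∀ {x} → A x ≡ true → A (x ⁻¹) ≡ true

  InverseClosed⇒⁻¹-invariant : ∀ {A} → InverseClosed A → ∀ x → A (x ⁻¹) ≡ A x
  InverseClosed⇒⁻¹-invariant {A} A⁻¹⊆A x = ≡true-ext
    (λ x⁻¹∈A → subst (λ z → A z ≡ true) (⁻¹-involutive x) (A⁻¹⊆A x⁻¹∈A))
    A⁻¹⊆A

  bar-·-bar≡card : ∀ A C x → _·_ G (bar G A) (bar G C) x ≡ + card G (λ u → A u ∧ C (u ⁻¹ ∙ x))
  bar-·-bar≡card A C x = trans
    (cong (foldr ℤ._+_ (+ 0)) (map-cong (λ u → indicator-∧ (A u) (C (u ⁻¹ ∙ x))) elements))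
    (Σ[G]-bar (λ u → A u ∧ C (u ⁻¹ ∙ x)))

  bar-·-bar≡neighboursIn : ∀ {A} → InverseClosed A → ∀ C x
    → _·_ G (bar G A) (bar G C) x ≡ + neighboursIn G A C x
  bar-·-bar≡neighboursIn {A} A⁻¹⊆A C x = begin
    _·_ G (bar G A) (bar G C) x
      ≡⟨ bar-·-bar≡card A C x ⟩
    + card G (λ u → A u ∧ C (u ⁻¹ ∙ x))
      ≡⟨ cong +_ (sym (card-∘-inverse _ ([x∙y⁻¹]⁻¹∙x≡y x) (x∙[y⁻¹∙x]⁻¹≡y x))) ⟩
    + card G (λ y → A (x ∙ y ⁻¹) ∧ C ((x ∙ y ⁻¹) ⁻¹ ∙ x))
      ≡⟨ cong +_ (card-cong λ y → cong₂ _∧_ (A[x∙y⁻¹]≡A[y∙x⁻¹] y) (cong C ([x∙y⁻¹]⁻¹∙x≡y x y))) ⟩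
    + neighboursIn G A C x
      ∎
    where
      open ≡-Reasoning
      A[x∙y⁻¹]≡A[y∙x⁻¹] : ∀ y → A (x ∙ y ⁻¹) ≡ A (y ∙ x ⁻¹)
      A[x∙y⁻¹]≡A[y∙x⁻¹] y = trans (cong A (sym ([x∙y⁻¹]⁻¹≡y∙x⁻¹ y x)))
        (InverseClosed⇒⁻¹-invariant {A} A⁻¹⊆A (y ∙ x ⁻¹))

  module _ {H : Subset G} (H-subgroup : IsSubgroup G H) where
    open IsSubgroup H-subgroup

    ∈-∙-invariantʳ : ∀ {x} → H x ≡ true → ∀ y → H (y ∙ x) ≡ H y
    ∈-∙-invariantʳ x∈H y = ≡true-ext
      (λ yx∈H → subst (λ z → H z ≡ true) (//-rightDividesʳ _ y) (∙∈ yx∈H (⁻¹∈ x∈H)))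
      (λ y∈H → ∙∈ y∈H x∈H)

    ∉-∙⁻¹ : ∀ {x y} → ¬ (H x ≡ true) → H y ≡ true → H (y ∙ x ⁻¹) ≡ false
    ∉-∙⁻¹ {x} {y} x∉H y∈H = ¬-not λ yx⁻¹∈H →
      x∉H (subst (λ z → H z ≡ true) ([x∙y⁻¹]⁻¹∙x≡y y x) (∙∈ (⁻¹∈ yx⁻¹∈H) y∈H))

    ∖-InverseClosed : ∀ {S} → InverseClosed S → InverseClosed (_∖_ G S H)
    ∖-InverseClosed {S} S-closed {x} = subst (_≡ true) (sym (cong₂ (λ s h → s ∧ not h)
      (InverseClosed⇒⁻¹-invariant {S} S-closed x) (InverseClosed⇒⁻¹-invariant {H} ⁻¹∈ x)))

    neighboursIn-inside : ∀ S {x} → H x ≡ true → neighboursIn G S H x ≡ card G (_∩_ G S H)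
    neighboursIn-inside S {x} x∈H = trans
      (card-cong λ y → cong (S (y ∙ x ⁻¹) ∧_) (sym (∈-∙-invariantʳ (⁻¹∈ x∈H) y)))
      (card-∘-inverse (_∩_ G S H) (//-rightDividesˡ x) (//-rightDividesʳ x))

    neighboursIn-∖-inside : ∀ S {x} → H x ≡ true → neighboursIn G (_∖_ G S H) H x ≡ 0
    neighboursIn-∖-inside S x∈H = trans (neighboursIn-inside (_∖_ G S H) x∈H)
      (trans (card-cong λ y → [p∧¬q]∧q≡false (S y) (H y)) (count-false elements))

    neighboursIn-∖-outside : ∀ S {x} → ¬ (H x ≡ true)
      → neighboursIn G (_∖_ G S H) H x ≡ neighboursIn G S H x
    neighboursIn-∖-outside S {x} x∉H = card-cong λ y →
      [p∧¬q]∧r≡p∧r (S (y ∙ x ⁻¹)) (H (y ∙ x ⁻¹)) (H y) (∉-∙⁻¹ x∉H)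

module CoefficientsOverPerfectCode (G : FiniteGroup) {H S S₀ : Subset G}
  (H-subgroup : IsSubgroup G H) (S-closed : InverseClosed G S) (S₀-closed : InverseClosed G S₀)
  (code : IsPerfectCode G S₀ H) (b : ℕ) where

  open FiniteGroup G
  open IsRegularSet code using (inside; outside)
  open ≡-Reasoning

  CoefficientEquation : Carrier → Set
  CoefficientEquation x =
    _·_ G (bar G (_∖_ G S H)) (bar G H) x ≡ _⋆_ G (+ b) (_·_ G (bar G S₀) (bar G H)) x

  private
    lhs≡ : ∀ x → _·_ G (bar G (_∖_ G S H)) (bar G H) x ≡ + neighboursIn G (_∖_ G S H) H x
    lhs≡ = bar-·-bar≡neighboursIn G (∖-InverseClosed G H-subgroup {S} S-closed) H

    rhs≡ : ∀ x → _⋆_ G (+ b) (_·_ G (bar G S₀) (bar G H)) x ≡ + (b * neighboursIn G S₀ H x)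
    rhs≡ x = trans (cong (+ b ℤ.*_) (bar-·-bar≡neighboursIn G {S₀} S₀-closed H x)) (sym (pos-* b _))

  coefficient-inside : ∀ {x} → H x ≡ true → CoefficientEquation x
  coefficient-inside {x} x∈H = begin
    _·_ G (bar G (_∖_ G S H)) (bar G H) x        ≡⟨ lhs≡ x ⟩
    + neighboursIn G (_∖_ G S H) H x             ≡⟨ cong +_ (neighboursIn-∖-inside G H-subgroup S x∈H) ⟩
    + 0                                          ≡⟨ cong +_ (sym (*-zeroʳ b)) ⟩
    + (b * 0)                                    ≡⟨ cong (λ n → + (b * n)) (sym (inside x x∈H)) ⟩
    + (b * neighboursIn G S₀ H x)                ≡⟨ sym (rhs≡ x) ⟩
    _⋆_ G (+ b) (_·_ G (bar G S₀) (bar G H)) x   ∎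

  coefficient-outside : ∀ {x} → ¬ (H x ≡ true) → CoefficientEquation x ⇔ neighboursIn G S H x ≡ b
  coefficient-outside {x} x∉H = mk⇔
    (λ eq → +-injective (trans (sym lhs-outside) (trans eq rhs-outside)))
    (λ eq → trans lhs-outside (trans (cong +_ eq) (sym rhs-outside)))
    where
      lhs-outside : _·_ G (bar G (_∖_ G S H)) (bar G H) x ≡ + neighboursIn G S H x
      lhs-outside = trans (lhs≡ x) (cong +_ (neighboursIn-∖-outside G H-subgroup S x∉H))

      rhs-outside : _⋆_ G (+ b) (_·_ G (bar G S₀) (bar G H)) x ≡ + b
      rhs-outside = begin
        _⋆_ G (+ b) (_·_ G (bar G S₀) (bar G H)) x   ≡⟨ rhs≡ x ⟩
        + (b * neighboursIn G S₀ H x)                ≡⟨ cong (λ n → + (b * n)) (outside x x∉H) ⟩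
        + (b * 1)                                    ≡⟨ cong +_ (*-identityʳ b) ⟩
        + b                                          ∎

lemma2p3 : (G : FiniteGroup) (H S S₀ : Subset G) (a b : ℕ)
    → IsSubgroup G H
    → IsConnectionSet G S
    → IsConnectionSet G S₀
    → IsPerfectCode G S₀ H
    → IsRegularSet G S a b H
      ⇔ (card G (_∩_ G S H) ≡ a
         × _≈ZG_ G (_·_ G (bar G (_∖_ G S H)) (bar G H))
                   (_⋆_ G (+ b) (_·_ G (bar G S₀) (bar G H))))
lemma2p3 G H S S₀ a b H-subgroup S-connection S₀-connection code = mk⇔ regular⇒ ⇒regular
  where
    open FiniteGroup G using (ε)
    open IsSubgroup H-subgroup using (ε∈)
    open CoefficientsOverPerfectCode G {S = S} {S₀ = S₀} H-subgroup
      (IsConnectionSet.inv S-connection) (IsConnectionSet.inv S₀-connection) code b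

    regular⇒ : IsRegularSet G S a b H → card G (_∩_ G S H) ≡ a × (∀ x → CoefficientEquation x)
    regular⇒ regular = trans (sym (neighboursIn-inside G H-subgroup S ε∈)) (inside ε ε∈) , coefficient
      where
        open IsRegularSet regular
        coefficient : ∀ x → CoefficientEquation x
        coefficient x with H x Bool.≟ true
        ... | yes x∈H = coefficient-inside x∈H
        ... | no x∉H = Equivalence.from (coefficient-outside x∉H) (outside x x∉H)

    ⇒regular : card G (_∩_ G S H) ≡ a × (∀ x → CoefficientEquation x) → IsRegularSet G S a b H
    ⇒regular (|S∩H|≡a , coefficient) = record
      { nonempty = ε , ε∈
      ; proper = IsRegularSet.proper code
      ; inside = λ x x∈H → trans (neighboursIn-inside G H-subgroup S x∈H) |S∩H|≡a
      ; outside = λ x x∉H → Equivalence.to (coefficient-outside x∉H) (coefficient x)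
      }
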